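{- Let $G$ be an $\alpha$-erased graph with average degree $\overline{d}$, let $\varepsilon \in (0, 2/\overline{d})$ and $\alpha \in [0, \varepsilon/2)$. If $G$ is $\varepsilon$-far from connected, then the number of witnesses to disconnectedness in $G$ is at least $(\varepsilon-2\alpha)m$.
   Context: Graphs are simple and undirected, on a vertex set $V$ with $n=|V|$, represented by adjacency lists. For $\alpha\in[0,1]$, an $\alpha$-erased graph is the concatenation of the adjacency lists of a simple undirected graph $(V,E)$ in which at most $2\alpha|E|$ entries have been replaced by a special symbol $\bot$ (erased). A completion of $G$ is the adjacency-list representation of a simple undirected graph on $V$ that coincides with $G$ on all nonerased entries (list lengths unchanged). $m$ is half the total length of all adjacency lists, $\overline{d}=2m/n$. $G$ is $\varepsilon$-far from connected if every completion of $G$ differs in at least $\varepsilon m$ edges from every connected graph. A set $C\subseteq V$ is a witness to disconnectedness in $G$ if the adjacency lists of the vertices in $C$ contain no erased entries and $C$ forms a connected component in every completion of $G$. -}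

module Defs where

open import Data.Nat using (ℕ; suc)
open import Data.Nat.Properties using (_<?_)
open import Data.Fin using (Fin; toℕ)
open import Data.Fin.Properties using (_≟_)
open import Data.Fin.Subset using (Subset; _∈_)
open import Data.Nat.ListAction using (sum)
open import Data.List using (List; []; _∷_; length; filter; map; cartesianProduct; allFin; concat)
import Data.List.Membership.Propositional as LM
open import Data.List.Relation.Unary.Any using (any?)
open import Data.List.Relation.Unary.All using (All)
open import Data.List.Relation.Unary.Unique.Propositional using (Unique)
open import Data.List.Relation.Binary.Pointwise using (Pointwise)
open import Data.Maybe using (Maybe; just; nothing; Is-just)
open import Data.Product using (Σ; _×_; _,_; proj₁; proj₂; ∃)
open import Data.Unit using (⊤)
open import Data.Bool using (Bool; true; false; _xor_)
open import Relation.Nullary using (¬_; Dec; yes; no)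
open import Relation.Nullary.Decidable using (⌊_⌋)
open import Relation.Binary.PropositionalEquality using (_≡_)
open import Relation.Binary.Construct.Closure.ReflexiveTransitive using (Star)
open import Function using (_⇔_)
open import Data.Integer using (+_)
open import Data.Rational using (ℚ; _/_; _*_; _-_; _≤_; _<_)

AdjLists : ℕ → Set
AdjLists n = Fin n → List (Fin n)

record IsSimple {n : ℕ} (L : AdjLists n) : Set where
  field
    noDup     : ∀ v → Unique (L v)
    noLoop    : ∀ v → ¬ (v LM.∈ L v)
    symmetric : ∀ u v → u LM.∈ L v → v LM.∈ L u

Adj : ∀ {n} → AdjLists n → Fin n → Fin n → Set
Adj L u v = v LM.∈ L u

adj? : ∀ {n} → AdjLists n → Fin n → Fin n → Bool
adj? L u v = ⌊ any? (v ≟_) (L u) ⌋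

Connected : ∀ {n} → AdjLists n → Set
Connected L = ∀ u v → Star (Adj L) u v

pairs : (n : ℕ) → List (Fin n × Fin n)
pairs n = filter (λ p → toℕ (proj₁ p) <? toℕ (proj₂ p)) (cartesianProduct (allFin n) (allFin n))

edgeDist : ∀ {n} → AdjLists n → AdjLists n → ℕ
edgeDist {n} L H =
  length (filter (λ p → adj? L (proj₁ p) (proj₂ p) xor adj? H (proj₁ p) (proj₂ p) Data.Bool.≟ true) (pairs n))
  where import Data.Bool

-- Erased graph: adjacency lists whose entries are either a vertex (just v)
-- or the erasure symbol ⊥ (nothing).
ErasedGraph : ℕ → Set
ErasedGraph n = Fin n → List (Maybe (Fin n))

-- m = half of the total length of all adjacency lists (total length = 2m).
totalLength : ∀ {n} → ErasedGraph n → ℕ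
totalLength {n} G = sum (map (λ v → length (G v)) (allFin n))

erasedIn : ∀ {n} → List (Maybe (Fin n)) → ℕ
erasedIn [] = 0
erasedIn (nothing ∷ es) = suc (erasedIn es)
erasedIn (just _ ∷ es) = erasedIn es

erasedCount : ∀ {n} → ErasedGraph n → ℕ
erasedCount {n} G = sum (map (λ v → erasedIn (G v)) (allFin n))

mQ : ∀ {n} → ErasedGraph n → ℚ
mQ G = + totalLength G / 2

-- nonerased entries must agree; list lengths unchanged (Pointwise)
Agrees : ∀ {n} → Maybe (Fin n) → Fin n → Set
Agrees nothing  _ = ⊤
Agrees (just u) w = u ≡ w

IsCompletion : ∀ {n} → ErasedGraph n → AdjLists n → Set
IsCompletion {n} G L = IsSimple L × (∀ v → Pointwise Agrees (G v) (L v))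

IsAlphaErased : ∀ {n} → ℚ → ErasedGraph n → Set
IsAlphaErased {n} α G =
  (∃ λ (L : AdjLists n) → IsCompletion G L) ×
  (+ erasedCount G / 1 ≤ (+ 2 / 1) * α * mQ G)

FarFromConnected : ∀ {n} → ℚ → ErasedGraph n → Set
FarFromConnected {n} ε G =
  ∀ (L : AdjLists n) → IsCompletion G L →
  ∀ (H : AdjLists n) → IsSimple H → Connected H →
  ε * mQ G ≤ + edgeDist L H / 1

IsComponent : ∀ {n} → AdjLists n → Subset n → Set
IsComponent {n} L C =
  (∃ λ u → u ∈ C) × (∀ u → u ∈ C → ∀ v → (v ∈ C ⇔ Star (Adj L) u v))

IsWitness : ∀ {n} → ErasedGraph n → Subset n → Set
IsWitness {n} G C =
  (∀ v → v ∈ C → All Is-just (G v)) ×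
  (∀ (L : AdjLists n) → IsCompletion G L → IsComponent L C)

module Submission where

-- Fix a completion L of G. A component of L whose lists carry no erased entry is a witness:
-- every completion agrees with L on those lists, so the component survives in all of them.
-- Joining vertex 0 to the least vertex of each such component and to every vertex with an
-- erased entry makes L connected, since every other component contains a vertex with an
-- erased entry. That changes at most (#vertices with an erased entry) + #witnesses ≤ 2αm + #witnesses
-- edges, while ε-farness says it changes at least εm.

open import Defs
open import Level using (Level)
open import Data.Nat as ℕ using (ℕ; zero; suc; z≤n; s≤s)
import Data.Nat.Properties as ℕ
open import Data.Nat.Divisibility using (∣1⇒≡1)
open import Data.Nat.ListAction using (sum)
open import Data.Integer as ℤ using (+_)
import Data.Integer.Properties as ℤ
open import Data.Rational as ℚ using (ℚ; mkℚ; _/_; _*_; _-_; _≤_; _<_; 0ℚ)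
import Data.Rational.Properties as ℚ
import Data.Rational.Unnormalised as ℚᵘ
import Data.Rational.Unnormalised.Properties as ℚᵘ
open import Algebra.Properties.AbelianGroup ℚ.+-0-abelianGroup using (xyx⁻¹≈y)
open import Data.Fin as Fin using (Fin; zero; suc; toℕ)
open import Data.Fin.Properties using (any?; all?; _≟_; <-cmp)
open import Data.Fin.Induction using (<-wellFounded)
open import Data.Fin.Subset using (Subset; _∈_; _⊃_; ⁅_⁆)
open import Data.Fin.Subset.Properties using (_∈?_; x∈⁅x⁆; x∈⁅y⁆⇒x≡y)
open import Data.Fin.Subset.Induction using (⊃-wellFounded)
open import Data.Vec using (tabulate)
open import Data.Vec.Properties using (lookup∘tabulate; []=⇒lookup; lookup⇒[]=)
open import Data.List using (List; []; _∷_; length; filter; map; cartesianProduct; allFin)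
open import Data.List.Properties using (filter-++; length-++; length-map; filter-none)
open import Data.List.Membership.Propositional using () renaming (_∈_ to _∈ₗ_)
open import Data.List.Membership.Propositional.Properties using (∈-filter⁺; ∈-filter⁻; ∈-allFin)
import Data.List.Relation.Unary.Any as Any
open import Data.List.Relation.Unary.All as All using (All; []; _∷_)
import Data.List.Relation.Unary.All.Properties as All
open import Data.List.Relation.Unary.AllPairs using (AllPairs; []; _∷_)
import Data.List.Relation.Unary.AllPairs.Properties as AllPairs
open import Data.List.Relation.Unary.Unique.Propositional using (Unique)
import Data.List.Relation.Unary.Unique.Propositional.Properties as Unique
open import Data.List.Relation.Binary.Pointwise using (Pointwise; []; _∷_)
open import Data.Maybe using (Maybe; just; nothing; Is-just)
import Data.Maybe.Relation.Unary.Any as MaybeAny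
open import Data.Product using (Σ; ∃-syntax; _×_; _,_; proj₁; proj₂)
open import Data.Sum using (_⊎_; inj₁; inj₂)
open import Data.Unit using (tt)
open import Data.Bool as Bool using (Bool; true; false; _∨_; _xor_)
open import Data.Bool.Properties using (∨-identityʳ; ∨-zeroʳ; ∨-comm)
open import Function using (_∘_; _⇔_; mk⇔; Equivalence)
open import Induction.WellFounded using (Acc; acc)
open import Relation.Nullary using (¬_; Dec; yes; no; ¬?; does; contradiction)
open import Relation.Nullary.Decidable
  using (T?; dec-true; does-≡; isYes≗does; map′; _⊎-dec_; _×-dec_; _→-dec_)
open import Relation.Unary using (Pred; Decidable)
open import Relation.Unary.Properties using (_∪?_; _×?_)
open import Relation.Binary.Definitions using (tri<; tri≈; tri>)
open import Relation.Binary.PropositionalEquality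
  using (_≡_; refl; sym; trans; cong; cong₂; subst; subst₂)
import Relation.Binary.Construct.Closure.ReflexiveTransitive as Star
open import Relation.Binary.Construct.Closure.ReflexiveTransitive using (Star; _◅_; _◅◅_; reverse)

private
  variable
    a p q r : Level
    A : Set a
    n : ℕ

-- Counting with filter

module _ {P : Pred A p} {Q : Pred A q} (P? : Decidable P) (Q? : Decidable Q) where

  length-filter-∪ : ∀ xs →
    length (filter (P? ∪? Q?) xs) ℕ.≤ length (filter P? xs) ℕ.+ length (filter Q? xs)
  length-filter-∪ [] = z≤n
  length-filter-∪ (x ∷ xs) with ih ← length-filter-∪ xs | P? x | Q? x
  ... | yes _ | yes _ = s≤s (ℕ.≤-trans ih (ℕ.+-monoʳ-≤ _ (ℕ.n≤1+n _)))
  ... | yes _ | no  _ = s≤s ih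
  ... | no  _ | yes _ = ℕ.≤-trans (s≤s ih) (ℕ.≤-reflexive (sym (ℕ.+-suc _ _)))
  ... | no  _ | no  _ = ih

  length-filter-filter-≤ : ∀ {R : Pred A r} (R? : Decidable R) → (∀ {x} → R x → P x → Q x) →
    ∀ xs → length (filter P? (filter R? xs)) ℕ.≤ length (filter Q? xs)
  length-filter-filter-≤ R? R∩P⊆Q [] = z≤n
  length-filter-filter-≤ R? R∩P⊆Q (x ∷ xs) with ih ← length-filter-filter-≤ R? R∩P⊆Q xs | R? x | Q? x
  ... | no  _  | yes _ = ℕ.m≤n⇒m≤1+n ih
  ... | no  _  | no  _ = ih
  ... | yes rx | qx? with P? x | qx?
  ...   | yes px | no ¬qx = contradiction (R∩P⊆Q rx px) ¬qx
  ...   | yes _  | yes _  = s≤s ih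
  ...   | no  _  | yes _  = ℕ.m≤n⇒m≤1+n ih
  ...   | no  _  | no  _  = ih

module _ {B : Set q} {P : Pred A p} {Q : Pred B r} (P? : Decidable P) (Q? : Decidable Q) where

  private
    length-filter-×-map : ∀ {x} → P x → ∀ ys →
      length (filter (P? ×? Q?) (map (x ,_) ys)) ≡ length (filter Q? ys)
    length-filter-×-map px [] = refl
    length-filter-×-map {x} px (y ∷ ys) with ih ← length-filter-×-map px ys | P? x | Q? y
    ... | no ¬px | _     = contradiction px ¬px
    ... | yes _  | yes _ = cong suc ih
    ... | yes _  | no  _ = ih

    filter-×-map-reject : ∀ {x} → ¬ P x → ∀ ys → filter (P? ×? Q?) (map (x ,_) ys) ≡ []
    filter-×-map-reject ¬px ys =
      filter-none (P? ×? Q?) (All.map⁺ (All.universal (λ _ → ¬px ∘ proj₁) ys))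

    length-filter-cartesianProduct-∷ : ∀ x xs ys →
      length (filter (P? ×? Q?) (cartesianProduct (x ∷ xs) ys))
      ≡ length (filter (P? ×? Q?) (map (x ,_) ys)) ℕ.+ length (filter (P? ×? Q?) (cartesianProduct xs ys))
    length-filter-cartesianProduct-∷ x xs ys =
      trans (cong length (filter-++ (P? ×? Q?) (map (x ,_) ys) (cartesianProduct xs ys)))
            (length-++ (filter (P? ×? Q?) (map (x ,_) ys)))

  length-filter-×-cartesianProduct : ∀ xs ys →
    length (filter (P? ×? Q?) (cartesianProduct xs ys)) ≡ length (filter P? xs) ℕ.* length (filter Q? ys)
  length-filter-×-cartesianProduct [] ys = refl
  length-filter-×-cartesianProduct (x ∷ xs) ys with P? x
  ... | yes px = trans (length-filter-cartesianProduct-∷ x xs ys)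
    (cong₂ ℕ._+_ (length-filter-×-map px ys) (length-filter-×-cartesianProduct xs ys))
  ... | no ¬px = trans (length-filter-cartesianProduct-∷ x xs ys)
    (cong₂ ℕ._+_ (cong length (filter-×-map-reject ¬px ys)) (length-filter-×-cartesianProduct xs ys))

length-filter-positive≤sum : (f : A → ℕ) (pos? : Decidable (λ x → 0 ℕ.< f x)) →
  ∀ xs → length (filter pos? xs) ℕ.≤ sum (map f xs)
length-filter-positive≤sum f pos? [] = z≤n
length-filter-positive≤sum f pos? (x ∷ xs) with ih ← length-filter-positive≤sum f pos? xs | pos? x
... | yes 0<fx = ℕ.+-mono-≤ 0<fx ih
... | no  _    = ℕ.≤-trans ih (ℕ.m≤n+m _ (f x))

length-filter-≟zero : ∀ k → length (filter (_≟ zero) (allFin (suc k))) ≡ 1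
length-filter-≟zero k =
  cong (suc ∘ length) (filter-none (_≟ zero) (All.tabulate⁺ {n = k} {f = suc} (λ _ ())))

AllPairs-map-within : ∀ {P : Pred A p} {R S : A → A → Set q} →
  (∀ {x y} → P x → P y → R x y → S x y) → ∀ {xs} → All P xs → AllPairs R xs → AllPairs S xs
AllPairs-map-within R⇒S [] [] = []
AllPairs-map-within R⇒S (px ∷ pxs) (rs ∷ rss) =
  All.zipWith (λ (py , r) → R⇒S px py r) (pxs , rs) ∷ AllPairs-map-within R⇒S pxs rss

xor-∨-true : ∀ x y → x xor (x ∨ y) ≡ true → y ≡ true
xor-∨-true false y eq = eq
xor-∨-true true  _ ()

fromDec : {P : Pred (Fin n) p} → Decidable P → Subset n
fromDec P? = tabulate (does ∘ P?)

module _ {P : Pred (Fin n) p} (P? : Decidable P) where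

  ∈-fromDec⁺ : ∀ {x} → P x → x ∈ fromDec P?
  ∈-fromDec⁺ {x} px = lookup⇒[]= x _ (trans (lookup∘tabulate _ x) (dec-true (P? x) px))

  ∈-fromDec⁻ : ∀ {x} → x ∈ fromDec P? → P x
  ∈-fromDec⁻ {x} x∈ with P? x | trans (sym (lookup∘tabulate (does ∘ P?) x)) ([]=⇒lookup x∈)
  ... | yes px | _ = px
  ... | no  _  | ()

-- Adjacency lists

module _ (M : AdjLists n) where

  Adj? : ∀ a b → Dec (Adj M a b)
  Adj? a b = Any.any? (b ≟_) (M a)

  adj?≡does : ∀ {a b} (ab? : Dec (Adj M a b)) → adj? M a b ≡ does ab?
  adj?≡does {a} {b} ab? = trans (isYes≗does (Adj? a b)) (does-≡ (Adj? a b) ab?)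

  adj?-sound : ∀ {a b} → adj? M a b ≡ true → Adj M a b
  adj?-sound {a} {b} eq with Adj? a b
  ... | yes ab = ab
  ... | no  _  = contradiction eq λ ()

  adj?-complete : ∀ {a b} → Adj M a b → adj? M a b ≡ true
  adj?-complete {a} {b} ab = trans (isYes≗does (Adj? a b)) (dec-true (Adj? a b) ab)

  module _ (simple : IsSimple M) where

    adj?-symmetric : ∀ a b → adj? M a b ≡ adj? M b a
    adj?-symmetric a b = trans
      (adj?≡does (map′ (IsSimple.symmetric simple a b) (IsSimple.symmetric simple b a) (Adj? b a)))
      (sym (isYes≗does (Adj? b a)))

    Star-Adj-symmetric : ∀ {u v} → Star (Adj M) u v → Star (Adj M) v u
    Star-Adj-symmetric = reverse (λ {a} {b} → IsSimple.symmetric simple b a)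

    IsComponent-reachable : ∀ {C r} → (∀ v → v ∈ C ⇔ Star (Adj M) r v) → IsComponent M C
    IsComponent-reachable {C} {r} C⇔reach = (r , from r Star.ε) , λ u u∈C v →
      mk⇔ (λ v∈C → Star-Adj-symmetric (to u u∈C) ◅◅ to v v∈C)
          (λ uv → from v (to u u∈C ◅◅ uv))
      where
      to : ∀ v → v ∈ C → Star (Adj M) r v
      to v = Equivalence.to (C⇔reach v)
      from : ∀ v → Star (Adj M) r v → v ∈ C
      from v = Equivalence.from (C⇔reach v)

module _ {M M′ : AdjLists n} where

  Star-Adj-transport : ∀ {a b} → (∀ v → Star (Adj M) a v → M′ v ≡ M v) →
    Star (Adj M) a b → Star (Adj M′) a b
  Star-Adj-transport agree Star.ε = Star.ε
  Star-Adj-transport {a} agree (ac ◅ p) =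
    subst (_ ∈ₗ_) (sym (agree a Star.ε)) ac ◅ Star-Adj-transport (λ v cv → agree v (ac ◅ cv)) p

  Star-Adj-transport⁻ : ∀ {a b} → (∀ v → Star (Adj M) a v → M′ v ≡ M v) →
    Star (Adj M′) a b → Star (Adj M) a b
  Star-Adj-transport⁻ agree Star.ε = Star.ε
  Star-Adj-transport⁻ {a} agree (ac ◅ p) =
    acᴹ ◅ Star-Adj-transport⁻ (λ v cv → agree v (acᴹ ◅ cv)) p
    where acᴹ = subst (_ ∈ₗ_) (agree a Star.ε) ac

module Reachability (L : AdjLists n) where

  Reach : Fin n → Fin n → Set
  Reach = Star (Adj L)

  Closed : Subset n → Set
  Closed T = ∀ {a b} → a ∈ T → Adj L a b → b ∈ T

  Closed-Reach : ∀ {T a b} → Closed T → a ∈ T → Reach a b → b ∈ T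
  Closed-Reach closed a∈T Star.ε   = a∈T
  Closed-Reach closed a∈T (ab ◅ p) = Closed-Reach closed (closed a∈T ab) p

  private
    Expansion : Subset n → Fin n → Set
    Expansion T b = b ∈ T ⊎ ∃[ a ] (a ∈ T × Adj L a b)

    expansion? : ∀ T → Decidable (Expansion T)
    expansion? T b = b ∈? T ⊎-dec any? (λ a → a ∈? T ×-dec Adj? L a b)

    expand : Subset n → Subset n
    expand T = fromDec (expansion? T)

    grow : ∀ {u} T → Acc _⊃_ T → u ∈ T → (∀ {b} → b ∈ T → Reach u b) →
           ∃[ C ] (u ∈ C × Closed C × (∀ {b} → b ∈ C → Reach u b))
    grow {u} T (acc larger) u∈T T⊆ with any? (λ b → b ∈? expand T ×-dec ¬? (b ∈? T))
    ... | yes (b , b∈ , b∉T) = grow (expand T) (larger (T⊆expand , b , b∈ , b∉T)) (T⊆expand u∈T) expand⊆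
      where
      T⊆expand : ∀ {b} → b ∈ T → b ∈ expand T
      T⊆expand b∈T = ∈-fromDec⁺ (expansion? T) (inj₁ b∈T)
      expand⊆ : ∀ {b} → b ∈ expand T → Reach u b
      expand⊆ b∈ with ∈-fromDec⁻ (expansion? T) b∈
      ... | inj₁ b∈T            = T⊆ b∈T
      ... | inj₂ (a , a∈T , ab) = T⊆ a∈T ◅◅ (ab ◅ Star.ε)
    ... | no nothing-new = T , u∈T , closed , T⊆
      where
      closed : Closed T
      closed {a} {b} a∈T ab with b ∈? T
      ... | yes b∈T = b∈T
      ... | no  b∉T = contradiction (b , ∈-fromDec⁺ (expansion? T) (inj₂ (a , a∈T , ab)) , b∉T) nothing-new

  reach? : ∀ u v → Dec (Reach u v)
  reach? u v with grow ⁅ u ⁆ (⊃-wellFounded ⁅ u ⁆) (x∈⁅x⁆ u) (λ b∈ → subst (Reach u) (sym (x∈⁅y⁆⇒x≡y u b∈)) Star.ε)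
  ... | C , u∈C , closed , C⊆ = map′ C⊆ (Closed-Reach closed u∈C) (v ∈? C)

  reachableFrom : Fin n → Subset n
  reachableFrom u = fromDec (reach? u)

  reachableFrom-self : ∀ u → u ∈ reachableFrom u
  reachableFrom-self u = ∈-fromDec⁺ (reach? u) Star.ε

module HubAugmentation {k} (L : AdjLists (suc k)) (L-simple : IsSimple L)
                       {S : Pred (Fin (suc k)) p} (S? : Decidable S) where

  spoke : Fin (suc k) → Fin (suc k) → Bool
  spoke zero (suc b) = does (S? (suc b))
  spoke _    _       = false

  edge : Fin (suc k) → Fin (suc k) → Bool
  edge a b = adj? L a b ∨ (spoke a b ∨ spoke b a)

  H : AdjLists (suc k)
  H a = filter (T? ∘ edge a) (allFin (suc k))

  adj?-H : ∀ a b → adj? H a b ≡ edge a b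
  adj?-H a b = adj?≡does H
    (map′ (∈-filter⁺ (T? ∘ edge a) (∈-allFin b)) (proj₂ ∘ ∈-filter⁻ (T? ∘ edge a)) (T? (edge a b)))

  spoke-irreflexive : ∀ v → spoke v v ≡ false
  spoke-irreflexive zero    = refl
  spoke-irreflexive (suc v) = refl

  spoke-sound : ∀ a b → spoke a b ≡ true → a ≡ zero × S b
  spoke-sound zero (suc b) eq with S? (suc b)
  ... | yes s = refl , s
  spoke-sound zero    zero ()
  spoke-sound (suc a) b    ()

  edge-symmetric : ∀ a b → edge a b ≡ edge b a
  edge-symmetric a b = cong₂ _∨_ (adj?-symmetric L L-simple a b) (∨-comm (spoke a b) (spoke b a))

  H-simple : IsSimple H
  H-simple = record
    { noDup     = λ a → Unique.filter⁺ (T? ∘ edge a) (Unique.allFin⁺ (suc k))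
    ; noLoop    = λ v v∈Hv → IsSimple.noLoop L-simple v (adj?-sound L (loop-in-L v (adj?-complete H v∈Hv)))
    ; symmetric = λ u v u∈Hv → adj?-sound H (begin
        adj? H u v ≡⟨ adj?-H u v ⟩
        edge u v   ≡⟨ edge-symmetric u v ⟩
        edge v u   ≡⟨ adj?-H v u ⟨
        adj? H v u ≡⟨ adj?-complete H u∈Hv ⟩
        true       ∎)
    }
    where
    open Relation.Binary.PropositionalEquality.≡-Reasoning
    loop-in-L : ∀ v → adj? H v v ≡ true → adj? L v v ≡ true
    loop-in-L v loop = begin
      adj? L v v                                ≡⟨ ∨-identityʳ (adj? L v v) ⟨
      adj? L v v ∨ (false ∨ false)              ≡⟨ cong (λ s → adj? L v v ∨ (s ∨ s)) (spoke-irreflexive v) ⟨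
      edge v v                                  ≡⟨ adj?-H v v ⟨
      adj? H v v                                ≡⟨ loop ⟩
      true                                      ∎

  H-connected : (∀ u → ∃[ s ] (Star (Adj L) u s × S s)) → Connected H
  H-connected reaches-S u v = to-hub u ◅◅ Star-Adj-symmetric H H-simple (to-hub v)
    where
    L⊆H : ∀ {a b} → Adj L a b → Adj H a b
    L⊆H {a} {b} ab = adj?-sound H (trans (adj?-H a b) (cong (_∨ (spoke a b ∨ spoke b a)) (adj?-complete L ab)))

    spoke-to-hub : ∀ {s} → S s → Star (Adj H) s zero
    spoke-to-hub {zero}  _ = Star.ε
    spoke-to-hub {suc j} s = adj?-sound H (trans (adj?-H (suc j) zero)
      (trans (cong (λ b → adj? L (suc j) zero ∨ (false ∨ b)) (dec-true (S? (suc j)) s)) (∨-zeroʳ _))) ◅ Star.ε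

    to-hub : ∀ u → Star (Adj H) u zero
    to-hub u with s , us , s∈S ← reaches-S u = Star.map L⊆H us ◅◅ spoke-to-hub s∈S

  edgeDist-H : edgeDist L H ℕ.≤ length (filter S? (allFin (suc k)))
  edgeDist-H = begin
    edgeDist L H
      ≤⟨ length-filter-filter-≤ differ? ((_≟ zero) ×? S?) ordered? differ⇒spoke (cartesianProduct V V) ⟩
    length (filter ((_≟ zero) ×? S?) (cartesianProduct V V))
      ≡⟨ length-filter-×-cartesianProduct (_≟ zero) S? V V ⟩
    length (filter (_≟ zero) V) ℕ.* length (filter S? V)
      ≡⟨ cong (ℕ._* length (filter S? V)) (length-filter-≟zero k) ⟩
    1 ℕ.* length (filter S? V)
      ≡⟨ ℕ.*-identityˡ _ ⟩
    length (filter S? V) ∎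
    where
    open ℕ.≤-Reasoning
    V : List (Fin (suc k))
    V = allFin (suc k)

    Differ : Fin (suc k) × Fin (suc k) → Set
    Differ (a , b) = (adj? L a b xor adj? H a b) ≡ true
    differ? : Decidable Differ
    differ? (a , b) = (adj? L a b xor adj? H a b) Bool.≟ true

    Ordered : Fin (suc k) × Fin (suc k) → Set
    Ordered (a , b) = toℕ a ℕ.< toℕ b
    ordered? : Decidable Ordered
    ordered? (a , b) = toℕ a ℕ.<? toℕ b

    differ⇒spoke : ∀ {e} → Ordered e → Differ e → (proj₁ e ≡ zero) × S (proj₂ e)
    differ⇒spoke {a , suc j} _ differ = spoke-sound a (suc j) (trans (sym (∨-identityʳ (spoke a (suc j))))
      (xor-∨-true (adj? L a (suc j)) _ (subst (λ e → (adj? L a (suc j) xor e) ≡ true) (adj?-H a (suc j)) differ)))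

-- Erased graphs

HasErasure : ErasedGraph n → Fin n → Set
HasErasure G v = 0 ℕ.< erasedIn (G v)

hasErasure? : (G : ErasedGraph n) → Decidable (HasErasure G)
hasErasure? G v = 0 ℕ.<? erasedIn (G v)

length-filter-hasErasure≤erasedCount : (G : ErasedGraph n) →
  length (filter (hasErasure? G) (allFin n)) ℕ.≤ erasedCount G
length-filter-hasErasure≤erasedCount G =
  length-filter-positive≤sum (erasedIn ∘ G) (hasErasure? G) (allFin _)

All-Is-just : (xs : List (Maybe (Fin n))) → ¬ (0 ℕ.< erasedIn xs) → All Is-just xs
All-Is-just []             _ = []
All-Is-just (nothing ∷ xs) h = contradiction (s≤s z≤n) h
All-Is-just (just _  ∷ xs) h = MaybeAny.just tt ∷ All-Is-just xs h

Agrees-functional : ∀ {xs : List (Maybe (Fin n))} {ys zs} → All Is-just xs →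
  Pointwise Agrees xs ys → Pointwise Agrees xs zs → ys ≡ zs
Agrees-functional [] [] [] = refl
Agrees-functional (MaybeAny.just _ ∷ js) (y ∷ ys) (z ∷ zs) =
  cong₂ _∷_ (trans (sym y) z) (Agrees-functional js ys zs)

module Witnesses (G : ErasedGraph n) (L : AdjLists n) (L-completes : IsCompletion G L) where

  open Reachability L

  Root : Fin n → Set
  Root r = (∀ v → Reach r v → ¬ v Fin.< r) × (∀ v → Reach r v → ¬ HasErasure G v)

  root? : Decidable Root
  root? r = all? (λ v → reach? r v →-dec ¬? (v Fin.<? r))
     ×-dec all? (λ v → reach? r v →-dec ¬? (hasErasure? G v))

  roots : List (Fin n)
  roots = filter root? (allFin n)

  witnesses : List (Subset n)
  witnesses = map reachableFrom roots

  reachableFrom-isWitness : ∀ {r} → Root r → IsWitness G (reachableFrom r)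
  reachableFrom-isWitness {r} (_ , clean) = unerased , isComponent
    where
    unerased : ∀ v → v ∈ reachableFrom r → All Is-just (G v)
    unerased v v∈ = All-Is-just (G v) (clean v (∈-fromDec⁻ (reach? r) v∈))

    isComponent : ∀ L′ → IsCompletion G L′ → IsComponent L′ (reachableFrom r)
    isComponent L′ (L′-simple , L′-agrees) = IsComponent-reachable L′ L′-simple λ v →
      mk⇔ (Star-Adj-transport agree ∘ ∈-fromDec⁻ (reach? r))
          (∈-fromDec⁺ (reach? r) ∘ Star-Adj-transport⁻ agree)
      where
      agree : ∀ v → Reach r v → L′ v ≡ L v
      agree v rv = Agrees-functional (All-Is-just (G v) (clean v rv)) (L′-agrees v) (proj₂ L-completes v)

  reachableFrom-injectiveOnRoots : ∀ {x y} → Root x → Root y → reachableFrom x ≡ reachableFrom y → x ≡ y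
  reachableFrom-injectiveOnRoots {x} {y} (x-least , _) (y-least , _) eq with <-cmp x y
  ... | tri< x<y _ _ =
    contradiction x<y (y-least x (∈-fromDec⁻ (reach? y) (subst (x ∈_) eq (reachableFrom-self x))))
  ... | tri≈ _ x≡y _ = x≡y
  ... | tri> _ _ y<x =
    contradiction y<x (x-least y (∈-fromDec⁻ (reach? x) (subst (y ∈_) (sym eq) (reachableFrom-self y))))

  witnesses-unique : Unique witnesses
  witnesses-unique = AllPairs.map⁺ (AllPairs-map-within
    (λ rx ry x≢y → x≢y ∘ reachableFrom-injectiveOnRoots rx ry)
    (All.all-filter root? (allFin n)) (Unique.filter⁺ root? (Unique.allFin⁺ n)))

  witnesses-areWitnesses : All (IsWitness G) witnesses
  witnesses-areWitnesses = All.map⁺ (All.map reachableFrom-isWitness (All.all-filter root? (allFin n)))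

  reaches-erasure-or-root : ∀ u → ∃[ s ] (Reach u s × (HasErasure G s ⊎ Root s))
  reaches-erasure-or-root u = go u (<-wellFounded u)
    where
    go : ∀ u → Acc Fin._<_ u → ∃[ s ] (Reach u s × (HasErasure G s ⊎ Root s))
    go u (acc smaller) with any? (λ v → reach? u v ×-dec hasErasure? G v)
    ... | yes (e , ue , e-erased) = e , ue , inj₁ e-erased
    ... | no no-erasure with any? (λ v → reach? u v ×-dec v Fin.<? u)
    ...   | yes (w , uw , w<u) with s , ws , source ← go w (smaller w<u) = s , uw ◅◅ ws , source
    ...   | no no-smaller =
      u , Star.ε , inj₂ ((λ v uv v<u → no-smaller (v , uv , v<u)) , (λ v uv e → no-erasure (v , uv , e)))

-- Rational arithmetic

ι : ℕ → ℚ
ι a = + a / 1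

private
  ι≡mkℚ : ∀ a → ι a ≡ mkℚ (+ a) 0 (λ (_ , d∣1) → ∣1⇒≡1 d∣1)
  ι≡mkℚ a = ℚ.normalize-coprime _

ι-mono-≤ : ∀ {a b} → a ℕ.≤ b → ι a ≤ ι b
ι-mono-≤ {a} {b} a≤b rewrite ι≡mkℚ a | ι≡mkℚ b =
  ℚ.*≤* (subst₂ ℤ._≤_ (sym (ℤ.*-identityʳ (+ a))) (sym (ℤ.*-identityʳ (+ b))) (ℤ.+≤+ a≤b))

ι-homo-+ : ∀ a b → ι (a ℕ.+ b) ≡ ι a ℚ.+ ι b
ι-homo-+ a b = ℚ.toℚᵘ-injective (ℚᵘ.≃-trans toℚᵘ-ι-+ (ℚᵘ.≃-sym (ℚ.toℚᵘ-homo-+ (ι a) (ι b))))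
  where
  toℚᵘ-ι-+ : ℚ.toℚᵘ (ι (a ℕ.+ b)) ℚᵘ.≃ ℚ.toℚᵘ (ι a) ℚᵘ.+ ℚ.toℚᵘ (ι b)
  toℚᵘ-ι-+ rewrite ι≡mkℚ (a ℕ.+ b) | ι≡mkℚ a | ι≡mkℚ b
                 | ℤ.*-identityʳ (+ a) | ℤ.*-identityʳ (+ b) = ℚᵘ.*≡* refl

distance-bound⇒witness-bound : ∀ ε c m {d e w} →
  ε * m ≤ ι d → d ℕ.≤ e ℕ.+ w → ι e ≤ c * m → (ε - c) * m ≤ ι w
distance-bound⇒witness-bound ε c m {d} {e} {w} εm≤d d≤e+w e≤cm = begin
  (ε - c) * m                   ≡⟨ ℚ.*-distribʳ-+ m ε (ℚ.- c) ⟩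
  ε * m ℚ.+ ℚ.- c * m           ≡⟨ cong (ε * m ℚ.+_) (ℚ.neg-distribˡ-* c m) ⟨
  ε * m - c * m                 ≤⟨ ℚ.+-monoˡ-≤ (ℚ.- (c * m)) εm≤d ⟩
  ι d - c * m                   ≤⟨ ℚ.+-monoˡ-≤ (ℚ.- (c * m)) (ι-mono-≤ d≤e+w) ⟩
  ι (e ℕ.+ w) - c * m           ≡⟨ cong (_- c * m) (ι-homo-+ e w) ⟩
  ι e ℚ.+ ι w - c * m           ≤⟨ ℚ.+-monoˡ-≤ (ℚ.- (c * m)) (ℚ.+-monoˡ-≤ (ι w) e≤cm) ⟩
  c * m ℚ.+ ι w - c * m         ≡⟨ xyx⁻¹≈y (c * m) (ι w) ⟩
  ι w                           ∎
  where open ℚ.≤-Reasoning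

claim2p2 : (n : ℕ) (G : ErasedGraph n) (ε α : ℚ) →
    IsAlphaErased α G →
    0ℚ < ε → ε * (+ totalLength G / 1) < (+ 2 / 1) * (+ n / 1) →
    0ℚ ≤ α → α * (+ 2 / 1) < ε →
    FarFromConnected ε G →
    Σ (List (Subset n)) (λ ws → Unique ws × All (IsWitness G) ws ×
    (ε - (+ 2 / 1) * α) * mQ G ≤ + length ws / 1)
claim2p2 zero G ε α _ _ _ _ _ _ = [] , [] , [] , ℚ.≤-reflexive (ℚ.*-zeroʳ (ε - (+ 2 / 1) * α))
claim2p2 (suc k) G ε α ((L , L-completes) , few-erasures) _ _ _ _ far =
  witnesses , witnesses-unique , witnesses-areWitnesses ,
  distance-bound⇒witness-bound ε ((+ 2 / 1) * α) (mQ G) {edgeDist L H} {erasedCount G} {length witnesses}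
    (far L L-completes H H-simple (H-connected reaches-erasure-or-root)) distance≤ few-erasures
  where
  open Witnesses G L L-completes
  open HubAugmentation L (proj₁ L-completes) (hasErasure? G ∪? root?)

  distance≤ : edgeDist L H ℕ.≤ erasedCount G ℕ.+ length witnesses
  distance≤ = begin
    edgeDist L H                                                    ≤⟨ edgeDist-H ⟩
    length (filter (hasErasure? G ∪? root?) (allFin (suc k)))         ≤⟨ length-filter-∪ (hasErasure? G) root? (allFin (suc k)) ⟩
    length (filter (hasErasure? G) (allFin (suc k))) ℕ.+ length roots ≤⟨ ℕ.+-monoˡ-≤ _ (length-filter-hasErasure≤erasedCount G) ⟩
    erasedCount G ℕ.+ length roots                                  ≡⟨ cong (erasedCount G ℕ.+_) (length-map _ roots) ⟨
    erasedCount G ℕ.+ length witnesses                              ∎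
    where open ℕ.≤-Reasoning
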